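{- For every $n\geq 0$ there is a bijection between: - (i) decorated alternative tableaux of length $n$; and - (ii) pairs $(T,M)$ where $T$ is an alternative tableau of length $n$ with no free row and $M$ is a subset of the set of rows and columns of $T$ (the rows and columns in $M$ being "marked").
   Context: A shape of length $n$ is a Ferrers diagram in English notation (possibly with empty rows or columns), determined by its south-east border, a path of $n$ unit south/west steps from the top-right to the bottom-left corner; south steps correspond to rows, west steps to columns. An alternative tableau is a shape with a partial filling of cells by left arrows and up arrows such that every cell to the left of a left arrow in its row, and every cell above an up arrow in its column, is empty. Its length is that of its shape. A free row is a row with no left arrow. A decorated alternative tableau is an alternative tableau in which each arrow is in one of two states, marked or unmarked; an alternative tableau with $k$ arrows gives $2^k$ decorated alternative tableaux. -}

module Defs where

open import Data.Bool using (Bool; true; false; _∧_; _∨_; not; T)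
open import Data.Nat using (ℕ; _<ᵇ_)
open import Data.Fin using (Fin; toℕ)
open import Data.Fin.Subset using (Subset)
open import Data.List using (List; allFin)
open import Data.Bool.ListAction using (all; any)
open import Data.Vec using (Vec; lookup)
open import Data.Maybe using (Maybe; just; nothing)
open import Data.Product using (Σ; _×_; _,_; proj₁)

-- Steps of the south-east border, read from the top-right corner to the
-- bottom-left corner.  S = south step (a row), W = west step (a column).
data Step : Set where
  S W : Step

isS : Step → Bool
isS S = true
isS W = false

isW : Step → Bool
isW s = not (isS s)

-- Rows are the positions i with step S, columns the positions j with step W;
-- rows are ordered top to bottom and columns right to left by position.
Shape : ℕ → Set
Shape n = Vec Step n

_<F_ : ∀ {n} → Fin n → Fin n → Bool
i <F j = toℕ i <ᵇ toℕ j

isCell : ∀ {n} → Shape n → Fin n → Fin n → Bool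
isCell s i j = isS (lookup s i) ∧ isW (lookup s j) ∧ (i <F j)

data Arrow : Set where
  left up : Arrow

isLeft : Maybe Arrow → Bool
isLeft (just left) = true
isLeft _           = false

isUp : Maybe Arrow → Bool
isUp (just up) = true
isUp _         = false

isEmpty : Maybe Arrow → Bool
isEmpty nothing  = true
isEmpty (just _) = false

-- A partial filling: entry (i , j) is the content of the cell in row i and
-- column j (nothing = empty).  Positions that are not cells must be empty.
Filling : ℕ → Set
Filling n = Vec (Vec (Maybe Arrow) n) n

entry : ∀ {n} → Filling n → Fin n → Fin n → Maybe Arrow
entry f i j = lookup (lookup f i) j

_⇒ᵇ_ : Bool → Bool → Bool
a ⇒ᵇ b = not a ∨ b

forallFin : (n : ℕ) → (Fin n → Bool) → Bool
forallFin n p = all p (allFin n)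

existsFin : (n : ℕ) → (Fin n → Bool) → Bool
existsFin n p = any p (allFin n)

-- Alternative tableau condition:
--  * only cells of the shape carry arrows;
--  * every cell to the left of a left arrow (same row, a column j' whose
--    west step comes later) is empty;
--  * every cell above an up arrow (same column, a row i' whose south step
--    comes earlier) is empty.
isAlternative : ∀ {n} → Shape n → Filling n → Bool
isAlternative {n} s f =
  forallFin n λ i → forallFin n λ j →
       (not (isEmpty (entry f i j)) ⇒ᵇ isCell s i j)
     ∧ (isLeft (entry f i j) ⇒ᵇ forallFin n (λ j' → (j <F j') ⇒ᵇ isEmpty (entry f i j')))
     ∧ (isUp (entry f i j)   ⇒ᵇ forallFin n (λ i' → (i' <F i) ⇒ᵇ isEmpty (entry f i' j)))

AltTableau : ℕ → Set
AltTableau n = Σ (Shape n) λ s → Σ (Filling n) λ f → T (isAlternative s f)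

noFreeRow : ∀ {n} → AltTableau n → Bool
noFreeRow {n} (s , f , _) =
  forallFin n λ i → isS (lookup s i) ⇒ᵇ existsFin n (λ j → isLeft (entry f i j))

AltTableauNoFreeRow : ℕ → Set
AltTableauNoFreeRow n = Σ (AltTableau n) λ t → T (noFreeRow t)

-- Decorated fillings: every arrow carries a mark (true = marked).
DFilling : ℕ → Set
DFilling n = Vec (Vec (Maybe (Arrow × Bool)) n) n

forget : ∀ {n} → DFilling n → Filling n
forget = Data.Vec.map (Data.Vec.map (Data.Maybe.map proj₁))

DecAltTableau : ℕ → Set
DecAltTableau n = Σ (Shape n) λ s → Σ (DFilling n) λ d → T (isAlternative s (forget d))

-- Rows and columns of a tableau of length n are indexed by the n border
-- steps, i.e. by Fin n; a set M of rows and columns is a Subset n.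
RowColSubset : ℕ → Set
RowColSubset n = Subset n

module Submission where

-- The bijection is built by induction on n, removing the first border step.  A
-- west step is an empty new column, which is free (has no up arrow); a south step
-- is a new top row, with arrows only in free columns of the rest, up arrows
-- anywhere there and at most one left arrow, everything to its left empty.  For
-- the induction, arrows carry labels in B and free columns labels in P:
--   FreeLabelled B P (n+1)      ↔ (⊤ ⊎ P) × FreeLabelled B (B ⊎ P) n,
--   NoFreeRowLabelled B P (n+1) ↔ P × NoFreeRowLabelled B (B ⊎ P) n,
-- which follow from the first-step bijection (modules FirstStep and Peel), the
-- classification of admissible top rows and two counting identities for a row.  Iterating both (correspondence) gives
-- FreeLabelled Bool P n ↔ NoFreeRowLabelled ⊤ Q n × Vec Bool n whenever
-- ⊤ ⊎ P ↔ Q × Bool; the proposition is the case P = Q = ⊤.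

open import Defs
open import Data.Bool using (Bool; true; false; _∧_; _∨_; not; T)
open import Data.Bool.Properties using (T-∧; T-∨; T-irrelevant; ∧-assoc; ∧-comm)
open import Data.Empty using (⊥; ⊥-elim)
open import Data.Fin using (Fin; zero; suc)
open import Data.List using (allFin)
open import Data.List.Membership.Propositional using (lose)
open import Data.List.Membership.Propositional.Properties using (∈-allFin)
import Data.List.Relation.Unary.All as All
open import Data.List.Relation.Unary.All.Properties using (all⁺; all⁻)
open import Data.List.Relation.Unary.Any using (satisfied)
open import Data.List.Relation.Unary.Any.Properties using (any⁺; any⁻)
import Data.Maybe as Maybe
open import Data.Maybe using (Maybe; just; nothing)
open import Data.Nat using (ℕ; zero; suc)
open import Data.Product using (Σ; ∃; _×_; _,_; proj₁; proj₂)
open import Data.Product.Algebra using (×-cong; Σ-assoc)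
open import Data.Product.Function.Dependent.Propositional using (Σ-↔)
open import Data.Sum using (_⊎_; inj₁; inj₂; [_,_])
open import Data.Sum.Algebra using (⊎-cong; ⊎-comm; ⊎-assoc)
open import Data.Unit using (⊤; tt)
open import Data.Vec using (Vec; []; _∷_; lookup; map; tabulate; replicate; tail)
open import Data.Vec.Properties using (lookup-map; lookup∘tabulate; tabulate-cong; map-∘; map-cong; map-id)
open import Function using (_∘_)
open import Function.Bundles using (_↔_; mk↔ₛ′; Equivalence; Inverse)
open import Function.Properties.Inverse using (↔-refl; ↔-sym; ↔-trans)
open import Function.Related.Propositional using (≡⇒; module EquationalReasoning)
open import Function.Related.TypeIsomorphisms using (Σ-distribʳ-⊎; ×-distribˡ-⊎; ×-distribʳ-⊎)
open import Relation.Binary.PropositionalEquality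
  using (_≡_; refl; sym; trans; cong; cong₂; subst; module ≡-Reasoning)
open import Relation.Nullary using (¬_)

∧-fst : ∀ {a b} → T (a ∧ b) → T a
∧-fst {a} = proj₁ ∘ Equivalence.to (T-∧ {a})

∧-snd : ∀ {a b} → T (a ∧ b) → T b
∧-snd {a} = proj₂ ∘ Equivalence.to (T-∧ {a})

∧-intro : ∀ {a b} → T a → T b → T (a ∧ b)
∧-intro p q = Equivalence.from T-∧ (p , q)

⇒-elim : ∀ {a b} → T (a ⇒ᵇ b) → T a → T b
⇒-elim {true} h _ = h

⇒-intro : ∀ {a b} → (T a → T b) → T (a ⇒ᵇ b)
⇒-intro {true}  h = h tt
⇒-intro {false} _ = tt

not-elim : ∀ {a} → T (not a) → ¬ T a
not-elim {false} _ ()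

not-intro : ∀ {a} → ¬ T a → T (not a)
not-intro {true}  h = h tt
not-intro {false} _ = tt

T-ext : ∀ {a b} → (T a → T b) → (T b → T a) → a ≡ b
T-ext {true}  {true}  _ _ = refl
T-ext {true}  {false} f _ = ⊥-elim (f tt)
T-ext {false} {true}  _ g = ⊥-elim (g tt)
T-ext {false} {false} _ _ = refl

forallFin⁻ : ∀ {n} {p : Fin n → Bool} → T (forallFin n p) → ∀ i → T (p i)
forallFin⁻ {n} {p} h i = All.lookup (all⁺ p (allFin n) h) (∈-allFin i)

forallFin⁺ : ∀ {n} {p : Fin n → Bool} → (∀ i → T (p i)) → T (forallFin n p)
forallFin⁺ {n} {p} h = all⁻ p {allFin n} (All.tabulate λ {i} _ → h i)

existsFin⁻ : ∀ {n} {p : Fin n → Bool} → T (existsFin n p) → ∃ λ i → T (p i)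
existsFin⁻ {n} {p} h = satisfied (any⁻ p (allFin n) h)

existsFin⁺ : ∀ {n} {p : Fin n → Bool} → ∃ (λ i → T (p i)) → T (existsFin n p)
existsFin⁺ {n} {p} (i , pᵢ) = any⁺ p (lose (∈-allFin i) pᵢ)

forallFin-suc : ∀ {n} (p : Fin (suc n) → Bool) → forallFin (suc n) p ≡ p zero ∧ forallFin n (p ∘ suc)
forallFin-suc {n} p = T-ext
  (λ h → ∧-intro (forallFin⁻ {p = p} h zero) (forallFin⁺ (forallFin⁻ {p = p} h ∘ suc)))
  (λ h → forallFin⁺ {p = p} λ { zero → ∧-fst h ; (suc i) → forallFin⁻ (∧-snd {p zero} h) i })

existsFin-suc : ∀ {n} (p : Fin (suc n) → Bool) → existsFin (suc n) p ≡ p zero ∨ existsFin n (p ∘ suc)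
existsFin-suc {n} p = T-ext
  (λ h → split (existsFin⁻ {p = p} h))
  (λ h → [ (λ q → existsFin⁺ {p = p} (zero , q)) , shift ] (Equivalence.to (T-∨ {p zero}) h))
  where
  shift : T (existsFin n (p ∘ suc)) → T (existsFin (suc n) p)
  shift h = let (i , r) = existsFin⁻ {p = p ∘ suc} h in existsFin⁺ {p = p} (suc i , r)
  split : ∃ (λ i → T (p i)) → T (p zero ∨ existsFin n (p ∘ suc))
  split (zero  , q) = Equivalence.from T-∨ (inj₁ q)
  split (suc i , q) = Equivalence.from (T-∨ {p zero}) (inj₂ (existsFin⁺ {p = p ∘ suc} (i , q)))

forallFin-cong : ∀ {n} {p q : Fin n → Bool} → (∀ i → p i ≡ q i) → forallFin n p ≡ forallFin n q
forallFin-cong {p = p} {q} eq =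
  T-ext (λ h → forallFin⁺ λ i → subst T (eq i) (forallFin⁻ {p = p} h i))
        (λ h → forallFin⁺ λ i → subst T (sym (eq i)) (forallFin⁻ {p = q} h i))

existsFin-cong : ∀ {n} {p q : Fin n → Bool} → (∀ i → p i ≡ q i) → existsFin n p ≡ existsFin n q
existsFin-cong {p = p} {q} eq =
  T-ext (λ h → let (i , r) = existsFin⁻ {p = p} h in existsFin⁺ {p = q} (i , subst T (eq i) r))
        (λ h → let (i , r) = existsFin⁻ {p = q} h in existsFin⁺ {p = p} (i , subst T (sym (eq i)) r))

-- Unit and empty laws for the (non-polymorphic) ⊤ and ⊥ used here; the
-- library versions are stated for level-polymorphic units.
⊤×↔ : ∀ {A : Set} → (⊤ × A) ↔ A
⊤×↔ = mk↔ₛ′ proj₂ (tt ,_) (λ _ → refl) (λ _ → refl)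

⊥⊎↔ : ∀ {A : Set} → (⊥ ⊎ A) ↔ A
⊥⊎↔ = mk↔ₛ′ (λ { (inj₁ ()) ; (inj₂ a) → a }) inj₂ (λ _ → refl) (λ { (inj₁ ()) ; (inj₂ _) → refl })

Σ-⊥× : ∀ {A : Set} {C : A → Set} → Σ A (λ a → ⊥ × C a) ↔ ⊥
Σ-⊥× = mk↔ₛ′ (λ ()) (λ ()) (λ ()) (λ ())

Σ-factor : ∀ {A X : Set} {C : A → Set} → Σ A (λ a → X × C a) ↔ (X × Σ A C)
Σ-factor = mk↔ₛ′ (λ (a , x , c) → x , a , c) (λ (x , a , c) → a , x , c) (λ _ → refl) (λ _ → refl)

⊎-exchange : ∀ (X Y Z : Set) → (X ⊎ (Y ⊎ Z)) ↔ (Y ⊎ (X ⊎ Z))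
⊎-exchange X Y Z = ↔-trans (↔-sym (⊎-assoc _ X Y Z)) (↔-trans (⊎-cong (⊎-comm X Y) ↔-refl) (⊎-assoc _ Y X Z))

×-exchange : ∀ (X Y Z : Set) → (X × (Y × Z)) ↔ (Y × (X × Z))
×-exchange X Y Z = mk↔ₛ′ (λ (x , y , z) → y , x , z) (λ (y , x , z) → x , y , z) (λ _ → refl) (λ _ → refl)

×⊤↔ : ∀ {A : Set} → (A × ⊤) ↔ A
×⊤↔ = mk↔ₛ′ proj₁ (_, tt) (λ _ → refl) (λ _ → refl)

vec-uncons : ∀ {A : Set} {n} → Vec A (suc n) ↔ (A × Vec A n)
vec-uncons = mk↔ₛ′ (λ { (a ∷ v) → a , v }) (λ (a , v) → a ∷ v) (λ _ → refl) (λ { (a ∷ v) → refl })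

vec-zero : ∀ {A : Set} → Vec A 0 ↔ ⊤
vec-zero = mk↔ₛ′ (λ _ → tt) (λ _ → []) (λ _ → refl) (λ { [] → refl })

empty-noArrow : ∀ (a : Maybe Arrow) → T (isEmpty a) → ¬ T (not (isEmpty a))
empty-noArrow nothing _ ()

empty-noLeft : ∀ (a : Maybe Arrow) → T (isEmpty a) → ¬ T (isLeft a)
empty-noLeft nothing _ ()

empty-noUp : ∀ (a : Maybe Arrow) → T (isEmpty a) → ¬ T (isUp a)
empty-noUp nothing _ ()

noArrow-empty : ∀ (a : Maybe Arrow) → ¬ T (not (isEmpty a)) → T (isEmpty a)
noArrow-empty nothing  _ = tt
noArrow-empty (just _) h = ⊥-elim (h tt)

cell-row : ∀ {n} (s : Shape n) i j → T (isCell s i j) → T (isS (lookup s i))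
cell-row s i j = ∧-fst

cell-column : ∀ {n} (s : Shape n) i j → T (isCell s i j) → T (isW (lookup s j))
cell-column s i j = ∧-fst ∘ ∧-snd {isS (lookup s i)}

cell-order : ∀ {n} (s : Shape n) i j → T (isCell s i j) → T (i <F j)
cell-order s i j = ∧-snd {isW (lookup s j)} ∘ ∧-snd {isS (lookup s i)}

leftClears : ∀ {n} → Filling n → Fin n → Fin n → Bool
leftClears {n} f i j = forallFin n (λ j′ → (j <F j′) ⇒ᵇ isEmpty (entry f i j′))

upClears : ∀ {n} → Filling n → Fin n → Fin n → Bool
upClears {n} f i j = forallFin n (λ i′ → (i′ <F i) ⇒ᵇ isEmpty (entry f i′ j))

cellCondition : ∀ {n} → Shape n → Filling n → Fin n → Fin n → Bool
cellCondition s f i j =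
    (not (isEmpty (entry f i j)) ⇒ᵇ isCell s i j)
  ∧ (isLeft (entry f i j) ⇒ᵇ leftClears f i j)
  ∧ (isUp (entry f i j) ⇒ᵇ upClears f i j)

record CellOK {n} (s : Shape n) (f : Filling n) (i j : Fin n) : Set where
  field
    arrowInCell    : T (not (isEmpty (entry f i j))) → T (isCell s i j)
    leftClearsRow  : T (isLeft (entry f i j)) → ∀ j′ → T (j <F j′) → T (isEmpty (entry f i j′))
    upClearsColumn : T (isUp (entry f i j)) → ∀ i′ → T (i′ <F i) → T (isEmpty (entry f i′ j))
open CellOK

alternative⁻ : ∀ {n} {s : Shape n} {f : Filling n} → T (isAlternative s f) → ∀ i j → CellOK s f i j
alternative⁻ {n} {s} {f} h i j = record
  { arrowInCell    = ⇒-elim inCell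
  ; leftClearsRow  = λ l j′ → ⇒-elim (forallFin⁻ {p = λ j′ → (j <F j′) ⇒ᵇ isEmpty (entry f i j′)} (⇒-elim leftOK l) j′)
  ; upClearsColumn = λ u i′ → ⇒-elim (forallFin⁻ {p = λ i′ → (i′ <F i) ⇒ᵇ isEmpty (entry f i′ j)} (⇒-elim upOK u) i′)
  }
  where
  inCellCond leftCond upCond : Bool
  inCellCond = not (isEmpty (entry f i j)) ⇒ᵇ isCell s i j
  leftCond   = isLeft (entry f i j) ⇒ᵇ leftClears f i j
  upCond     = isUp (entry f i j) ⇒ᵇ upClears f i j
  cond : T (cellCondition s f i j)
  cond = forallFin⁻ {p = cellCondition s f i} (forallFin⁻ {p = λ i → forallFin n (cellCondition s f i)} h i) j
  inCell : T inCellCond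
  inCell = ∧-fst {inCellCond} cond
  leftOK : T leftCond
  leftOK = ∧-fst {leftCond} (∧-snd {inCellCond} cond)
  upOK : T upCond
  upOK = ∧-snd {leftCond} (∧-snd {inCellCond} cond)

alternative⁺ : ∀ {n} {s : Shape n} {f : Filling n} → (∀ i j → CellOK s f i j) → T (isAlternative s f)
alternative⁺ ok = forallFin⁺ λ i → forallFin⁺ λ j → let c = ok i j in
  ∧-intro (⇒-intro (arrowInCell c))
          (∧-intro (⇒-intro λ l → forallFin⁺ λ j′ → ⇒-intro (leftClearsRow c l j′))
                   (⇒-intro λ u → forallFin⁺ λ i′ → ⇒-intro (upClearsColumn c u i′)))

emptyCell : ∀ {n} {s : Shape n} {f : Filling n} {i j} → T (isEmpty (entry f i j)) → CellOK s f i j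
emptyCell {f = f} {i} {j} em = record
  { arrowInCell    = ⊥-elim ∘ empty-noArrow (entry f i j) em
  ; leftClearsRow  = ⊥-elim ∘ empty-noLeft (entry f i j) em
  ; upClearsColumn = ⊥-elim ∘ empty-noUp (entry f i j) em
  }

allEmpty : ∀ {n} → Vec (Maybe Arrow) n → Bool
allEmpty []      = true
allEmpty (a ∷ r) = isEmpty a ∧ allEmpty r

allEmpty⁻ : ∀ {n} (r : Vec (Maybe Arrow) n) → T (allEmpty r) → ∀ j → T (isEmpty (lookup r j))
allEmpty⁻ (a ∷ r) h zero    = ∧-fst h
allEmpty⁻ (a ∷ r) h (suc j) = allEmpty⁻ r (∧-snd {isEmpty a} h) j

allEmpty⁺ : ∀ {n} (r : Vec (Maybe Arrow) n) → (∀ j → T (isEmpty (lookup r j))) → T (allEmpty r)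
allEmpty⁺ []      h = tt
allEmpty⁺ (a ∷ r) h = ∧-intro (h zero) (allEmpty⁺ r (h ∘ suc))

-- Admissibility of a new top row over the allowed columns F: arrows only in
-- allowed columns, and everything after a left arrow empty.  The positions
-- after position j are the columns further to the left.
rowOK : ∀ {n} → Vec Bool n → Vec (Maybe Arrow) n → Bool
rowOK []      []      = true
rowOK (b ∷ F) (a ∷ r) = (not (isEmpty a) ⇒ᵇ b) ∧ (isLeft a ⇒ᵇ allEmpty r) ∧ rowOK F r

record RowOK {n} (F : Vec Bool n) (r : Vec (Maybe Arrow) n) : Set where
  field
    arrowInAllowed : ∀ j → T (not (isEmpty (lookup r j))) → T (lookup F j)
    leftClearsRest : ∀ j → T (isLeft (lookup r j)) → ∀ j′ → T (j <F j′) → T (isEmpty (lookup r j′))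
open RowOK

rowOK⁻ : ∀ {n} (F : Vec Bool n) (r : Vec (Maybe Arrow) n) → T (rowOK F r) → RowOK F r
rowOK⁻ []      []      h = record { arrowInAllowed = λ () ; leftClearsRest = λ () }
rowOK⁻ (b ∷ F) (a ∷ r) h = record { arrowInAllowed = inAllowed ; leftClearsRest = clears }
  where
  headAllowed : T (not (isEmpty a) ⇒ᵇ b)
  headAllowed = ∧-fst {not (isEmpty a) ⇒ᵇ b} h
  headClears : T (isLeft a ⇒ᵇ allEmpty r)
  headClears = ∧-fst {isLeft a ⇒ᵇ allEmpty r} (∧-snd {not (isEmpty a) ⇒ᵇ b} h)
  tailOK : RowOK F r
  tailOK = rowOK⁻ F r (∧-snd {isLeft a ⇒ᵇ allEmpty r} (∧-snd {not (isEmpty a) ⇒ᵇ b} h))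
  inAllowed : ∀ j → T (not (isEmpty (lookup (a ∷ r) j))) → T (lookup (b ∷ F) j)
  inAllowed zero    = ⇒-elim headAllowed
  inAllowed (suc j) = arrowInAllowed tailOK j
  clears : ∀ j → T (isLeft (lookup (a ∷ r) j)) → ∀ j′ → T (j <F j′) → T (isEmpty (lookup (a ∷ r) j′))
  clears zero    l (suc j′) _  = allEmpty⁻ r (⇒-elim headClears l) j′
  clears (suc j) l (suc j′) lt = leftClearsRest tailOK j l j′ lt

rowOK⁺ : ∀ {n} (F : Vec Bool n) (r : Vec (Maybe Arrow) n) → RowOK F r → T (rowOK F r)
rowOK⁺ []      []      h = tt
rowOK⁺ (b ∷ F) (a ∷ r) h =
  ∧-intro (⇒-intro (arrowInAllowed h zero))
          (∧-intro (⇒-intro λ l → allEmpty⁺ r λ j → leftClearsRest h zero l (suc j) tt)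
                   (rowOK⁺ F r record { arrowInAllowed = arrowInAllowed h ∘ suc
                                      ; leftClearsRest = λ j l j′ → leftClearsRest h (suc j) l (suc j′) }))

noUpIn : ∀ {n} → Filling n → Fin n → Bool
noUpIn {n} f j = forallFin n (λ i → not (isUp (entry f i j)))

-- The free columns of a tableau: columns (west steps) containing no up
-- arrow.  These are exactly the columns in which a new top row may place arrows.
freeColumns : ∀ {n} → Shape n → Filling n → Vec Bool n
freeColumns s f = tabulate (λ j → isW (lookup s j) ∧ noUpIn f j)

freeColumn⁻ : ∀ {n} (s : Shape n) (f : Filling n) j → T (lookup (freeColumns s f) j)
            → T (isW (lookup s j)) × (∀ i → ¬ T (isUp (entry f i j)))
freeColumn⁻ s f j h =
  let h′ = subst T (lookup∘tabulate (λ j → isW (lookup s j) ∧ noUpIn f j) j) h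
  in ∧-fst h′ , λ i → not-elim (forallFin⁻ (∧-snd {isW (lookup s j)} h′) i)

freeColumn⁺ : ∀ {n} (s : Shape n) (f : Filling n) j → T (isW (lookup s j))
            → (∀ i → ¬ T (isUp (entry f i j))) → T (lookup (freeColumns s f) j)
freeColumn⁺ s f j w noUp = subst T (sym (lookup∘tabulate (λ j → isW (lookup s j) ∧ noUpIn f j) j))
                                   (∧-intro w (forallFin⁺ (not-intro ∘ noUp)))

isLeft-empty : ∀ (a : Maybe Arrow) → T (isEmpty a) → isLeft a ≡ false
isLeft-empty nothing _ = refl

isUp-empty : ∀ (a : Maybe Arrow) → T (isEmpty a) → isUp a ≡ false
isUp-empty nothing _ = refl

entry-tail : ∀ {n} (rows : Vec (Vec (Maybe Arrow) (suc n)) n) i j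
           → entry (map tail rows) i j ≡ lookup (lookup rows i) (suc j)
entry-tail rows i j = trans (cong (λ v → lookup v j) (lookup-map i tail rows)) (lookup-tail (lookup rows i))
  where
  lookup-tail : (v : Vec (Maybe Arrow) (suc _)) → lookup (tail v) j ≡ lookup v (suc j)
  lookup-tail (_ ∷ v) = refl

-- The condition on the top row after the first border step: a west step
-- has no cells in the top row, a south step gives an admissible row over the
-- free columns of the remaining tableau.
topRowOK : ∀ {n} → Step → Vec Bool n → Vec (Maybe Arrow) n → Bool
topRowOK S F r = rowOK F r
topRowOK W F r = allEmpty r

-- Columns of F that stay free after adding a row r: those where r has no
-- up arrow.
removeUp : ∀ {n} → Vec Bool n → Vec (Maybe Arrow) n → Vec Bool n
removeUp F r = tabulate (λ j → lookup F j ∧ not (isUp (lookup r j)))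

extendFree : ∀ {n} → Step → Vec Bool n → Vec (Maybe Arrow) n → Vec Bool (suc n)
extendFree W F r = true ∷ F
extendFree S F r = false ∷ removeUp F r

noFreeRowIn : ∀ {n} → Shape n → Filling n → Bool
noFreeRowIn {n} s f = forallFin n λ i → isS (lookup s i) ⇒ᵇ existsFin n (λ j → isLeft (entry f i j))

hasLeft : ∀ {n} → Vec (Maybe Arrow) n → Bool
hasLeft {n} r = existsFin n (λ j → isLeft (lookup r j))

-- Decomposition of a filling of length n+1 along the first border step x:
-- the corner entry e, the top row r₀, and the remaining rows.  An alternative
-- tableau of shape x ∷ s splits into an alternative tableau of shape s (the
-- remaining rows without their first column) and an admissible top row.
module FirstStep {n : ℕ} (s : Shape n) (e : Maybe Arrow) (r₀ : Vec (Maybe Arrow) n)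
                 (rows : Vec (Vec (Maybe Arrow) (suc n)) n) where
  open ≡-Reasoning

  whole : Filling (suc n)
  whole = (e ∷ r₀) ∷ rows

  rest : Filling n
  rest = map tail rows

  restFree : Vec Bool n
  restFree = freeColumns s rest

  record Split (x : Step) : Set where
    field
      cornerEmpty      : T (isEmpty e)
      firstColumnEmpty : ∀ i → T (isEmpty (lookup (lookup rows i) zero))
      restAlternative  : T (isAlternative s rest)
      topRowAdmissible : T (topRowOK x restFree r₀)
  open Split public

  -- Cells strictly below and left of the first row and column are cells of
  -- the remaining part; the converse needs, for up arrows, the top entry
  -- above them to be empty.
  innerCell⁻ : ∀ {x} i j → CellOK (x ∷ s) whole (suc i) (suc j) → CellOK s rest i j
  innerCell⁻ i j c = record
    { arrowInCell    = arrowInCell c ∘ subst (T ∘ not ∘ isEmpty) (entry-tail rows i j)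
    ; leftClearsRow  = λ l j′ lt → subst (T ∘ isEmpty) (sym (entry-tail rows i j′))
                         (leftClearsRow c (subst (T ∘ isLeft) (entry-tail rows i j) l) (suc j′) lt)
    ; upClearsColumn = λ u i′ lt → subst (T ∘ isEmpty) (sym (entry-tail rows i′ j))
                         (upClearsColumn c (subst (T ∘ isUp) (entry-tail rows i j) u) (suc i′) lt)
    }

  innerCell⁺ : ∀ {x} i j → CellOK s rest i j → (T (isUp (entry rest i j)) → T (isEmpty (lookup r₀ j)))
             → CellOK (x ∷ s) whole (suc i) (suc j)
  innerCell⁺ i j c topEmpty = record
    { arrowInCell    = arrowInCell c ∘ subst (T ∘ not ∘ isEmpty) (sym (entry-tail rows i j))
    ; leftClearsRow  = λ { l zero () ; l (suc j′) lt → subst (T ∘ isEmpty) (entry-tail rows i j′)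
                             (leftClearsRow c (subst (T ∘ isLeft) (sym (entry-tail rows i j)) l) j′ lt) }
    ; upClearsColumn = λ { u zero _ → topEmpty (subst (T ∘ isUp) (sym (entry-tail rows i j)) u)
                         ; u (suc i′) lt → subst (T ∘ isEmpty) (entry-tail rows i′ j)
                             (upClearsColumn c (subst (T ∘ isUp) (sym (entry-tail rows i j)) u) i′ lt) }
    }

  -- The top row of an alternative tableau is admissible: its arrows sit in
  -- columns that have no up arrow below (an up arrow clears its column).
  topRow⁻ : ∀ x → (∀ i j → CellOK (x ∷ s) whole i j) → T (topRowOK x restFree r₀)
  topRow⁻ W ok = allEmpty⁺ r₀ λ j → noArrow-empty _ (cell-row (W ∷ s) zero (suc j) ∘ arrowInCell (ok zero (suc j)))
  topRow⁻ S ok = rowOK⁺ restFree r₀ record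
    { arrowInAllowed = λ j a → freeColumn⁺ s rest j
        (cell-column (S ∷ s) zero (suc j) (arrowInCell (ok zero (suc j)) a))
        (λ i u → empty-noArrow _ (upClearsColumn (ok (suc i) (suc j)) (subst (T ∘ isUp) (entry-tail rows i j) u) zero tt) a)
    ; leftClearsRest = λ j l j′ → leftClearsRow (ok zero (suc j)) l (suc j′)
    }

  topCell⁺ : ∀ x → T (topRowOK x restFree r₀) → ∀ j → CellOK (x ∷ s) whole zero (suc j)
  topCell⁺ W h j = emptyCell (allEmpty⁻ r₀ h j)
  topCell⁺ S h j = record
    { arrowInCell    = λ a → ∧-intro (proj₁ (freeColumn⁻ s rest j (arrowInAllowed R j a))) tt
    ; leftClearsRow  = λ { l zero () ; l (suc j′) lt → leftClearsRest R j l j′ lt }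
    ; upClearsColumn = λ _ _ ()
    }
    where R = rowOK⁻ restFree r₀ h

  -- Above an up arrow of the remaining part the top row is empty, since the
  -- column of that arrow is not free.
  topEmptyAboveUp : ∀ x → T (topRowOK x restFree r₀) → ∀ i j → T (isUp (entry rest i j)) → T (isEmpty (lookup r₀ j))
  topEmptyAboveUp W h i j _ = allEmpty⁻ r₀ h j
  topEmptyAboveUp S h i j u =
    noArrow-empty _ λ a → proj₂ (freeColumn⁻ s rest j (arrowInAllowed (rowOK⁻ restFree r₀ h) j a)) i u

  split⁻ : ∀ x → T (isAlternative (x ∷ s) whole) → Split x
  split⁻ x h = record
    { cornerEmpty      = noArrow-empty e (cell-order (x ∷ s) zero zero ∘ arrowInCell (ok zero zero))
    ; firstColumnEmpty = λ i → noArrow-empty _ (cell-order (x ∷ s) (suc i) zero ∘ arrowInCell (ok (suc i) zero))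
    ; restAlternative  = alternative⁺ λ i j → innerCell⁻ i j (ok (suc i) (suc j))
    ; topRowAdmissible = topRow⁻ x ok
    }
    where ok = alternative⁻ h

  split⁺ : ∀ x → Split x → T (isAlternative (x ∷ s) whole)
  split⁺ x sp = alternative⁺ cell
    where
    cell : ∀ i j → CellOK (x ∷ s) whole i j
    cell zero    zero    = emptyCell (cornerEmpty sp)
    cell (suc i) zero    = emptyCell (firstColumnEmpty sp i)
    cell zero    (suc j) = topCell⁺ x (topRowAdmissible sp) j
    cell (suc i) (suc j) = innerCell⁺ i j (alternative⁻ (restAlternative sp) i j)
                                     (topEmptyAboveUp x (topRowAdmissible sp) i j)

  noUpIn-first : ∀ {x} → Split x → noUpIn whole zero ≡ true
  noUpIn-first sp = T-ext (λ _ → tt) λ _ → forallFin⁺ λ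
    { zero    → not-intro (empty-noUp e (cornerEmpty sp))
    ; (suc i) → not-intro (empty-noUp _ (firstColumnEmpty sp i)) }

  noUpIn-suc : ∀ j → noUpIn whole (suc j) ≡ not (isUp (lookup r₀ j)) ∧ noUpIn rest j
  noUpIn-suc j = trans (forallFin-suc (λ i → not (isUp (entry whole i (suc j)))))
    (cong (not (isUp (lookup r₀ j)) ∧_) (forallFin-cong λ i → cong (not ∘ isUp) (sym (entry-tail rows i j))))

  freeColumns-split : ∀ x → Split x → freeColumns (x ∷ s) whole ≡ extendFree x restFree r₀
  freeColumns-split W sp = cong₂ _∷_ (noUpIn-first sp) (tabulate-cong λ j →
    cong (isW (lookup s j) ∧_) (begin
      noUpIn whole (suc j)                           ≡⟨ noUpIn-suc j ⟩
      not (isUp (lookup r₀ j)) ∧ noUpIn rest j       ≡⟨ cong (λ b → not b ∧ noUpIn rest j)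
                                                            (isUp-empty _ (allEmpty⁻ r₀ (topRowAdmissible sp) j)) ⟩
      noUpIn rest j                                  ∎))
  freeColumns-split S sp = cong (false ∷_) (tabulate-cong λ j → let w = isW (lookup s j); u = not (isUp (lookup r₀ j)) in begin
      w ∧ noUpIn whole (suc j)                       ≡⟨ cong (w ∧_) (noUpIn-suc j) ⟩
      w ∧ (u ∧ noUpIn rest j)                        ≡⟨ cong (w ∧_) (∧-comm u _) ⟩
      w ∧ (noUpIn rest j ∧ u)                        ≡⟨ sym (∧-assoc w _ u) ⟩
      (w ∧ noUpIn rest j) ∧ u                        ≡⟨ cong (_∧ u) (sym (lookup∘tabulate (λ j → isW (lookup s j) ∧ noUpIn rest j) j)) ⟩
      lookup restFree j ∧ u                          ∎)

  noFreeRow-split : ∀ x → Split x → noFreeRowIn (x ∷ s) whole ≡ (isS x ⇒ᵇ hasLeft r₀) ∧ noFreeRowIn s rest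
  noFreeRow-split x sp = trans (forallFin-suc (λ i → isS (lookup (x ∷ s) i) ⇒ᵇ existsFin (suc n) (λ j → isLeft (entry whole i j))))
    (cong₂ (λ a b → (isS x ⇒ᵇ a) ∧ b) topRow-hasLeft
           (forallFin-cong λ i → cong (isS (lookup s i) ⇒ᵇ_) (innerRow-hasLeft i)))
    where
    topRow-hasLeft : existsFin (suc n) (λ j → isLeft (entry whole zero j)) ≡ hasLeft r₀
    topRow-hasLeft = trans (existsFin-suc (λ j → isLeft (entry whole zero j))) (cong (_∨ hasLeft r₀) (isLeft-empty e (cornerEmpty sp)))
    innerRow-hasLeft : ∀ i → existsFin (suc n) (λ j → isLeft (entry whole (suc i) j))
                           ≡ existsFin n (λ j → isLeft (entry rest i j))
    innerRow-hasLeft i = trans (existsFin-suc (λ j → isLeft (entry whole (suc i) j)))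
      (cong₂ _∨_ (isLeft-empty _ (firstColumnEmpty sp i))
                 (existsFin-cong λ j → cong isLeft (sym (entry-tail rows i j))))

-- Entries of labelled tableaux: arrows carrying a label from B.  Decorated
-- tableaux are the case B = Bool, plain tableaux the case B = ⊤.
Labelled : Set → Set
Labelled B = Maybe (Arrow × B)

unlabel : ∀ {B} → Labelled B → Maybe Arrow
unlabel = Maybe.map proj₁

LFilling : Set → ℕ → Set
LFilling B n = Vec (Vec (Labelled B) n) n

unlabelRows : ∀ {B m n} → Vec (Vec (Labelled B) n) m → Vec (Vec (Maybe Arrow) n) m
unlabelRows = map (map unlabel)

LTableau : Set → ℕ → Set
LTableau B n = Σ (Shape n) λ s → Σ (LFilling B n) λ d → T (isAlternative s (unlabelRows d))

free : ∀ {B n} → LTableau B n → Vec Bool n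
free (s , d , _) = freeColumns s (unlabelRows d)

noFreeRows : ∀ {B n} → LTableau B n → Bool
noFreeRows (s , d , _) = noFreeRowIn s (unlabelRows d)

LTableau-≡ : ∀ {B n} {s : Shape n} {d₁ d₂ : LFilling B n} {p₁ p₂}
           → d₁ ≡ d₂ → _≡_ {A = LTableau B n} (s , d₁ , p₁) (s , d₂ , p₂)
LTableau-≡ {p₁ = p₁} {p₂} refl = cong (λ p → _ , _ , p) (T-irrelevant p₁ p₂)

AdmissibleRow : Set → ∀ {n} → Vec Bool n → Set
AdmissibleRow B {n} F = Σ (Vec (Labelled B) n) λ r → T (rowOK F (map unlabel r))

AdmissibleRow-≡ : ∀ {B n} {F : Vec Bool n} {r₁ r₂ : Vec (Labelled B) n} {q₁ q₂}
                → r₁ ≡ r₂ → _≡_ {A = AdmissibleRow B F} (r₁ , q₁) (r₂ , q₂)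
AdmissibleRow-≡ {q₁ = q₁} {q₂} refl = cong (_ ,_) (T-irrelevant q₁ q₂)

-- The ways of extending a tableau t by a first border step: a west step
-- (an empty new column) or a south step with an admissible top row.
Extension : (B : Set) → ∀ {n} → LTableau B n → Set
Extension B t = ⊤ ⊎ AdmissibleRow B (free t)

Extended : Set → ℕ → Set
Extended B n = Σ (LTableau B n) (Extension B)

freeAfterRow : ∀ {B n} (F : Vec Bool n) → ⊤ ⊎ AdmissibleRow B F → Vec Bool (suc n)
freeAfterRow F (inj₁ _)       = true ∷ F
freeAfterRow F (inj₂ (r , _)) = false ∷ removeUp F (map unlabel r)

noFreeRowAfterRow : ∀ {B n} (F : Vec Bool n) → Bool → ⊤ ⊎ AdmissibleRow B F → Bool
noFreeRowAfterRow F b (inj₁ _)       = b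
noFreeRowAfterRow F b (inj₂ (r , _)) = hasLeft (map unlabel r) ∧ b

freeAfter : ∀ {B n} → Extended B n → Vec Bool (suc n)
freeAfter (t , e) = freeAfterRow (free t) e

noFreeRowAfter : ∀ {B n} → Extended B n → Bool
noFreeRowAfter (t , e) = noFreeRowAfterRow (free t) (noFreeRows t) e

unlabel-empty : ∀ {B} (a : Labelled B) → T (isEmpty (unlabel a)) → a ≡ nothing
unlabel-empty nothing _ = refl

allEmpty-replicate : ∀ {B} n → T (allEmpty (map unlabel (replicate {A = Labelled B} n nothing)))
allEmpty-replicate zero    = tt
allEmpty-replicate (suc n) = allEmpty-replicate n

allEmpty-unlabel : ∀ {B n} (r : Vec (Labelled B) n) → T (allEmpty (map unlabel r)) → r ≡ replicate n nothing
allEmpty-unlabel []      _ = refl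
allEmpty-unlabel (a ∷ r) h = cong₂ _∷_ (unlabel-empty a (∧-fst h)) (allEmpty-unlabel r (∧-snd {isEmpty (unlabel a)} h))

unlabel-tail : ∀ {B m n} (rows : Vec (Vec (Labelled B) (suc n)) m)
             → map tail (unlabelRows rows) ≡ unlabelRows (map tail rows)
unlabel-tail rows = begin
  map tail (map (map unlabel) rows)   ≡⟨ map-∘ tail (map unlabel) rows ⟨
  map (tail ∘ map unlabel) rows       ≡⟨ map-cong (λ { (_ ∷ _) → refl }) rows ⟩
  map (map unlabel ∘ tail) rows       ≡⟨ map-∘ (map unlabel) tail rows ⟩
  map (map unlabel) (map tail rows)   ∎
  where open ≡-Reasoning

tail-prepend : ∀ {A : Set} {m n} (a : A) (d : Vec (Vec A n) m) → map tail (map (a ∷_) d) ≡ d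
tail-prepend a d = trans (sym (map-∘ tail (a ∷_) d)) (map-id d)

prepend-tail : ∀ {B m n} (rows : Vec (Vec (Labelled B) (suc n)) m)
             → (∀ i → T (isEmpty (lookup (lookup (unlabelRows rows) i) zero)))
             → map (nothing ∷_) (map tail rows) ≡ rows
prepend-tail []                h = refl
prepend-tail ((a ∷ v) ∷ rows) h = cong₂ _∷_ (cong (_∷ v) (sym (unlabel-empty a (h zero)))) (prepend-tail rows (h ∘ suc))

prepended-empty : ∀ {B m n} (d : Vec (Vec (Labelled B) n) m) i
                → T (isEmpty (lookup (lookup (unlabelRows (map (nothing ∷_) d)) i) zero))
prepended-empty (v ∷ d) zero    = tt
prepended-empty (v ∷ d) (suc i) = prepended-empty d i

module Peel (B : Set) (n : ℕ) where

  peel : LTableau B (suc n) → Extended B n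
  peel (x ∷ s , (a ∷ r₀) ∷ rows , p) = (s , map tail rows , restAlt) , extension x (topRowAdmissible sp)
    where
    open FirstStep s (unlabel a) (map unlabel r₀) (unlabelRows rows)
    sp : Split x
    sp = split⁻ x p
    restAlt : T (isAlternative s (unlabelRows (map tail rows)))
    restAlt = subst (T ∘ isAlternative s) (unlabel-tail rows) (restAlternative sp)
    extension : ∀ x → T (topRowOK x restFree (map unlabel r₀)) → Extension B (s , map tail rows , restAlt)
    extension W _ = inj₁ tt
    extension S q = inj₂ (r₀ , subst (λ d → T (rowOK (freeColumns s d) (map unlabel r₀))) (unlabel-tail rows) q)

  graftAlt : ∀ x (s : Shape n) (d : LFilling B n) (r : Vec (Labelled B) n)
           → T (isAlternative s (unlabelRows d))
           → T (topRowOK x (freeColumns s (unlabelRows d)) (map unlabel r))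
           → T (isAlternative (x ∷ s) (unlabelRows ((nothing ∷ r) ∷ map (nothing ∷_) d)))
  graftAlt x s d r p q = split⁺ x record
    { cornerEmpty      = tt
    ; firstColumnEmpty = prepended-empty d
    ; restAlternative  = subst (T ∘ isAlternative s) (sym restEq) p
    ; topRowAdmissible = subst (λ d′ → T (topRowOK x (freeColumns s d′) (map unlabel r))) (sym restEq) q
    }
    where
    open FirstStep s nothing (map unlabel r) (unlabelRows (map (nothing ∷_) d))
    restEq : rest ≡ unlabelRows d
    restEq = trans (unlabel-tail (map (nothing ∷_) d)) (cong unlabelRows (tail-prepend nothing d))

  graft : Extended B n → LTableau B (suc n)
  graft ((s , d , p) , inj₁ _) =
    W ∷ s , (nothing ∷ replicate n nothing) ∷ map (nothing ∷_) d , graftAlt W s d _ p (allEmpty-replicate n)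
  graft ((s , d , p) , inj₂ (r , q)) =
    S ∷ s , (nothing ∷ r) ∷ map (nothing ∷_) d , graftAlt S s d r p q

  peel-graft : ∀ e → peel (graft e) ≡ e
  peel-graft ((s , d , p) , inj₁ _)       = west (tail-prepend nothing d)
    where
    west : ∀ {d₁ d₂ p₁ p₂} → d₁ ≡ d₂ → _≡_ {A = Extended B n} ((s , d₁ , p₁) , inj₁ tt) ((s , d₂ , p₂) , inj₁ tt)
    west {p₁ = p₁} {p₂} refl = cong (λ p → (s , _ , p) , inj₁ tt) (T-irrelevant p₁ p₂)
  peel-graft ((s , d , p) , inj₂ (r , q)) = south (tail-prepend nothing d)
    where
    south : ∀ {d₁ d₂ p₁ p₂ q₁ q₂} → d₁ ≡ d₂
          → _≡_ {A = Extended B n} ((s , d₁ , p₁) , inj₂ (r , q₁)) ((s , d₂ , p₂) , inj₂ (r , q₂))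
    south {p₁ = p₁} {p₂} {q₁} {q₂} refl with T-irrelevant p₁ p₂ | T-irrelevant q₁ q₂
    ... | refl | refl = refl

  graft-peel : ∀ t → graft (peel t) ≡ t
  graft-peel (W ∷ s , (a ∷ r₀) ∷ rows , p) = LTableau-≡ (cong₂ _∷_
      (cong₂ _∷_ (sym (unlabel-empty a (cornerEmpty sp))) (sym (allEmpty-unlabel r₀ (topRowAdmissible sp))))
      (prepend-tail rows (firstColumnEmpty sp)))
    where
    open FirstStep s (unlabel a) (map unlabel r₀) (unlabelRows rows)
    sp : Split W
    sp = split⁻ W p
  graft-peel (S ∷ s , (a ∷ r₀) ∷ rows , p) = LTableau-≡ (cong₂ _∷_
      (cong (_∷ r₀) (sym (unlabel-empty a (cornerEmpty sp))))
      (prepend-tail rows (firstColumnEmpty sp)))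
    where
    open FirstStep s (unlabel a) (map unlabel r₀) (unlabelRows rows)
    sp : Split S
    sp = split⁻ S p

  firstStep : LTableau B (suc n) ↔ Extended B n
  firstStep = mk↔ₛ′ peel graft peel-graft graft-peel

  free-peel : ∀ t → free t ≡ freeAfter (peel t)
  free-peel (W ∷ s , (a ∷ r₀) ∷ rows , p) =
    trans (freeColumns-split W (split⁻ W p)) (cong (λ d → true ∷ freeColumns s d) (unlabel-tail rows))
    where open FirstStep s (unlabel a) (map unlabel r₀) (unlabelRows rows)
  free-peel (S ∷ s , (a ∷ r₀) ∷ rows , p) =
    trans (freeColumns-split S (split⁻ S p))
          (cong (λ d → false ∷ removeUp (freeColumns s d) (map unlabel r₀)) (unlabel-tail rows))
    where open FirstStep s (unlabel a) (map unlabel r₀) (unlabelRows rows)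

  noFreeRows-peel : ∀ t → noFreeRows t ≡ noFreeRowAfter (peel t)
  noFreeRows-peel (W ∷ s , (a ∷ r₀) ∷ rows , p) =
    trans (noFreeRow-split W (split⁻ W p)) (cong (noFreeRowIn s) (unlabel-tail rows))
    where open FirstStep s (unlabel a) (map unlabel r₀) (unlabelRows rows)
  noFreeRows-peel (S ∷ s , (a ∷ r₀) ∷ rows , p) =
    trans (noFreeRow-split S (split⁻ S p)) (cong (λ d → hasLeft (map unlabel r₀) ∧ noFreeRowIn s d) (unlabel-tail rows))
    where open FirstStep s (unlabel a) (map unlabel r₀) (unlabelRows rows)

-- Admissible rows without a left arrow: at every allowed column an optional
-- labelled up arrow.
UpRow : Set → ∀ {n} → Vec Bool n → Set
UpRow B []          = ⊤
UpRow B (true ∷ F)  = Maybe B × UpRow B F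
UpRow B (false ∷ F) = UpRow B F

-- Admissible rows with a left arrow: at the first allowed column either the
-- labelled left arrow (all later entries empty) or an optional up arrow
-- followed by a row with a left arrow.
LeftRow : Set → ∀ {n} → Vec Bool n → Set
LeftRow B []          = ⊥
LeftRow B (true ∷ F)  = B ⊎ (Maybe B × LeftRow B F)
LeftRow B (false ∷ F) = LeftRow B F

RowKind : Set → ∀ {n} → Vec Bool n → Set
RowKind B F = UpRow B F ⊎ LeftRow B F

upCell : ∀ {B} → Maybe B → Labelled B
upCell = Maybe.map (up ,_)

upRow : ∀ {B n} (F : Vec Bool n) → UpRow B F → Vec (Labelled B) n
upRow []          _       = []
upRow (true ∷ F)  (h , x) = upCell h ∷ upRow F x
upRow (false ∷ F) x       = nothing ∷ upRow F x

leftRow : ∀ {B n} (F : Vec Bool n) → LeftRow B F → Vec (Labelled B) n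
leftRow {n = suc n} (true ∷ F) (inj₁ b)       = just (left , b) ∷ replicate n nothing
leftRow             (true ∷ F) (inj₂ (h , y)) = upCell h ∷ leftRow F y
leftRow             (false ∷ F) y             = nothing ∷ leftRow F y

rowOf : ∀ {B n} (F : Vec Bool n) → RowKind B F → Vec (Labelled B) n
rowOf F (inj₁ x) = upRow F x
rowOf F (inj₂ y) = leftRow F y

rowOK-empty : ∀ {B n} (F : Vec Bool n) → T (rowOK F (map unlabel (replicate {A = Labelled B} n nothing)))
rowOK-empty []      = tt
rowOK-empty (b ∷ F) = rowOK-empty F

upRow-ok : ∀ {B n} (F : Vec Bool n) (x : UpRow B F) → T (rowOK F (map unlabel (upRow F x)))
upRow-ok []          _             = tt
upRow-ok (true ∷ F)  (nothing , x) = upRow-ok F x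
upRow-ok (true ∷ F)  (just _ , x)  = upRow-ok F x
upRow-ok (false ∷ F) x             = upRow-ok F x

leftRow-ok : ∀ {B n} (F : Vec Bool n) (y : LeftRow B F) → T (rowOK F (map unlabel (leftRow F y)))
leftRow-ok {B} {suc n} (true ∷ F) (inj₁ _) = ∧-intro (allEmpty-replicate {B} n) (rowOK-empty {B} F)
leftRow-ok (true ∷ F)  (inj₂ (nothing , y)) = leftRow-ok F y
leftRow-ok (true ∷ F)  (inj₂ (just _ , y))  = leftRow-ok F y
leftRow-ok (false ∷ F) y                    = leftRow-ok F y

rowOf-ok : ∀ {B n} (F : Vec Bool n) (z : RowKind B F) → T (rowOK F (map unlabel (rowOf F z)))
rowOf-ok F (inj₁ x) = upRow-ok F x
rowOf-ok F (inj₂ y) = leftRow-ok F y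

consUp : ∀ {B n} (F : Vec Bool n) → Maybe B → RowKind B F → RowKind B (true ∷ F)
consUp F h (inj₁ x) = inj₁ (h , x)
consUp F h (inj₂ y) = inj₂ (inj₂ (h , y))

rowOf-consUp : ∀ {B n} (F : Vec Bool n) (h : Maybe B) z → rowOf (true ∷ F) (consUp F h z) ≡ upCell h ∷ rowOf F z
rowOf-consUp F h (inj₁ _) = refl
rowOf-consUp F h (inj₂ _) = refl

rowOf-skip : ∀ {B n} (F : Vec Bool n) (z : RowKind B F) → rowOf (false ∷ F) z ≡ nothing ∷ rowOf F z
rowOf-skip F (inj₁ _) = refl
rowOf-skip F (inj₂ _) = refl

classify : ∀ {B n} (F : Vec Bool n) (r : Vec (Labelled B) n) → T (rowOK F (map unlabel r)) → RowKind B F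
classify []          []                    _ = inj₁ tt
classify (true ∷ F)  (nothing ∷ r)         q = consUp F nothing (classify F r q)
classify (true ∷ F)  (just (up , b) ∷ r)   q = consUp F (just b) (classify F r q)
classify (true ∷ F)  (just (left , b) ∷ r) q = inj₂ (inj₁ b)
classify (false ∷ F) (nothing ∷ r)         q = classify F r q

rowOf-classify : ∀ {B n} (F : Vec Bool n) (r : Vec (Labelled B) n) q → rowOf F (classify F r q) ≡ r
rowOf-classify []          []                    _ = refl
rowOf-classify (true ∷ F)  (nothing ∷ r)         q =
  trans (rowOf-consUp F nothing (classify F r q)) (cong (nothing ∷_) (rowOf-classify F r q))
rowOf-classify (true ∷ F)  (just (up , b) ∷ r)   q =
  trans (rowOf-consUp F (just b) (classify F r q)) (cong (just (up , b) ∷_) (rowOf-classify F r q))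
rowOf-classify (true ∷ F)  (just (left , b) ∷ r) q = cong (just (left , b) ∷_) (sym (allEmpty-unlabel r (∧-fst q)))
rowOf-classify (false ∷ F) (nothing ∷ r)         q =
  trans (rowOf-skip F (classify F r q)) (cong (nothing ∷_) (rowOf-classify F r q))

classify-rowOf : ∀ {B n} (F : Vec Bool n) (z : RowKind B F) q → classify F (rowOf F z) q ≡ z
classify-rowOf []          (inj₁ tt)                   _ = refl
classify-rowOf (true ∷ F)  (inj₁ (nothing , x))        q = cong (consUp F nothing) (classify-rowOf F (inj₁ x) q)
classify-rowOf (true ∷ F)  (inj₁ (just b , x))         q = cong (consUp F (just b)) (classify-rowOf F (inj₁ x) q)
classify-rowOf (true ∷ F)  (inj₂ (inj₁ b))             q = refl
classify-rowOf (true ∷ F)  (inj₂ (inj₂ (nothing , y))) q = cong (consUp F nothing) (classify-rowOf F (inj₂ y) q)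
classify-rowOf (true ∷ F)  (inj₂ (inj₂ (just b , y)))  q = cong (consUp F (just b)) (classify-rowOf F (inj₂ y) q)
classify-rowOf (false ∷ F) (inj₁ x)                    q = classify-rowOf F (inj₁ x) q
classify-rowOf (false ∷ F) (inj₂ y)                    q = classify-rowOf F (inj₂ y) q

rowClassification : ∀ {B n} (F : Vec Bool n) → AdmissibleRow B F ↔ RowKind B F
rowClassification F = mk↔ₛ′ (λ (r , q) → classify F r q) (λ z → rowOf F z , rowOf-ok F z)
  (λ z → classify-rowOf F z (rowOf-ok F z))
  (λ (r , q) → AdmissibleRow-≡ {F = F} (rowOf-classify F r q))

upRowFree : ∀ {B n} (F : Vec Bool n) → UpRow B F → Vec Bool n
upRowFree []          _             = []
upRowFree (true ∷ F)  (nothing , x) = true ∷ upRowFree F x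
upRowFree (true ∷ F)  (just _ , x)  = false ∷ upRowFree F x
upRowFree (false ∷ F) x             = false ∷ upRowFree F x

leftRowFree : ∀ {B n} (F : Vec Bool n) → LeftRow B F → Vec Bool n
leftRowFree (true ∷ F)  (inj₁ _)             = true ∷ F
leftRowFree (true ∷ F)  (inj₂ (nothing , y)) = true ∷ leftRowFree F y
leftRowFree (true ∷ F)  (inj₂ (just _ , y))  = false ∷ leftRowFree F y
leftRowFree (false ∷ F) y                    = false ∷ leftRowFree F y

remainingFree : ∀ {B n} (F : Vec Bool n) → RowKind B F → Vec Bool n
remainingFree F (inj₁ x) = upRowFree F x
remainingFree F (inj₂ y) = leftRowFree F y

isLeftRow : ∀ {B n} (F : Vec Bool n) → RowKind B F → Bool
isLeftRow F (inj₁ _) = false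
isLeftRow F (inj₂ _) = true

hasLeft-cons : ∀ {n} (a : Maybe Arrow) (r : Vec (Maybe Arrow) n) → hasLeft (a ∷ r) ≡ isLeft a ∨ hasLeft r
hasLeft-cons a r = existsFin-suc (λ j → isLeft (lookup (a ∷ r) j))

hasLeft-upCell : ∀ {B n} (h : Maybe B) (r : Vec (Maybe Arrow) n) → hasLeft (unlabel (upCell h) ∷ r) ≡ hasLeft r
hasLeft-upCell nothing  r = hasLeft-cons nothing r
hasLeft-upCell (just _) r = hasLeft-cons (just up) r

hasLeft-upRow : ∀ {B n} (F : Vec Bool n) (x : UpRow B F) → hasLeft (map unlabel (upRow F x)) ≡ false
hasLeft-upRow []          _       = refl
hasLeft-upRow (true ∷ F)  (h , x) = trans (hasLeft-upCell h (map unlabel (upRow F x))) (hasLeft-upRow F x)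
hasLeft-upRow (false ∷ F) x       = trans (hasLeft-cons nothing (map unlabel (upRow F x))) (hasLeft-upRow F x)

hasLeft-leftRow : ∀ {B n} (F : Vec Bool n) (y : LeftRow B F) → hasLeft (map unlabel (leftRow F y)) ≡ true
hasLeft-leftRow {B} {suc n} (true ∷ F) (inj₁ _) = hasLeft-cons (just left) (map unlabel (replicate {A = Labelled B} n nothing))
hasLeft-leftRow (true ∷ F)  (inj₂ (h , y)) = trans (hasLeft-upCell h (map unlabel (leftRow F y))) (hasLeft-leftRow F y)
hasLeft-leftRow (false ∷ F) y              = trans (hasLeft-cons nothing (map unlabel (leftRow F y))) (hasLeft-leftRow F y)

removeUp-empty : ∀ {B n} (F : Vec Bool n) → removeUp F (map unlabel (replicate {A = Labelled B} n nothing)) ≡ F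
removeUp-empty []          = refl
removeUp-empty (true ∷ F)  = cong (true ∷_) (removeUp-empty F)
removeUp-empty (false ∷ F) = cong (false ∷_) (removeUp-empty F)

removeUp-upRow : ∀ {B n} (F : Vec Bool n) (x : UpRow B F) → removeUp F (map unlabel (upRow F x)) ≡ upRowFree F x
removeUp-upRow []          _             = refl
removeUp-upRow (true ∷ F)  (nothing , x) = cong (true ∷_) (removeUp-upRow F x)
removeUp-upRow (true ∷ F)  (just _ , x)  = cong (false ∷_) (removeUp-upRow F x)
removeUp-upRow (false ∷ F) x             = cong (false ∷_) (removeUp-upRow F x)

removeUp-leftRow : ∀ {B n} (F : Vec Bool n) (y : LeftRow B F) → removeUp F (map unlabel (leftRow F y)) ≡ leftRowFree F y
removeUp-leftRow {B} (true ∷ F) (inj₁ _)     = cong (true ∷_) (removeUp-empty {B} F)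
removeUp-leftRow (true ∷ F)  (inj₂ (nothing , y)) = cong (true ∷_) (removeUp-leftRow F y)
removeUp-leftRow (true ∷ F)  (inj₂ (just _ , y))  = cong (false ∷_) (removeUp-leftRow F y)
removeUp-leftRow (false ∷ F) y                    = cong (false ∷_) (removeUp-leftRow F y)

hasLeft-classify : ∀ {B n} (F : Vec Bool n) (ρ : AdmissibleRow B F)
                 → hasLeft (map unlabel (proj₁ ρ)) ≡ isLeftRow F (Inverse.to (rowClassification F) ρ)
hasLeft-classify F (r , q) = trans (cong (hasLeft ∘ map unlabel) (sym (rowOf-classify F r q))) (by-kind (classify F r q))
  where
  by-kind : ∀ z → hasLeft (map unlabel (rowOf F z)) ≡ isLeftRow F z
  by-kind (inj₁ x) = hasLeft-upRow F x
  by-kind (inj₂ y) = hasLeft-leftRow F y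

removeUp-classify : ∀ {B n} (F : Vec Bool n) (ρ : AdmissibleRow B F)
                  → removeUp F (map unlabel (proj₁ ρ)) ≡ remainingFree F (Inverse.to (rowClassification F) ρ)
removeUp-classify F (r , q) = trans (cong (removeUp F ∘ map unlabel) (sym (rowOf-classify F r q))) (by-kind (classify F r q))
  where
  by-kind : ∀ z → removeUp F (map unlabel (rowOf F z)) ≡ remainingFree F z
  by-kind (inj₁ x) = removeUp-upRow F x
  by-kind (inj₂ y) = removeUp-leftRow F y

Labels : Set → ∀ {n} → Vec Bool n → Set
Labels P []          = ⊤
Labels P (true ∷ F)  = P × Labels P F
Labels P (false ∷ F) = Labels P F

-- Counting identity for rows without left arrow: choosing an optional
-- B-labelled up arrow in each allowed column, then P-labelling the columns
-- that remain free, amounts to one label in B ⊎ P per allowed column.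
upRowLabels : ∀ {B P n} (F : Vec Bool n) → Σ (UpRow B F) (Labels P ∘ upRowFree F) ↔ Labels (B ⊎ P) F
upRowLabels []          = mk↔ₛ′ (λ _ → tt) (λ _ → tt , tt) (λ _ → refl) (λ _ → refl)
upRowLabels {B} {P} (true ∷ F) = ↔-trans firstColumn (×-cong ↔-refl (upRowLabels F))
  where
  firstColumn : Σ (UpRow B (true ∷ F)) (Labels P ∘ upRowFree (true ∷ F))
              ↔ ((B ⊎ P) × Σ (UpRow B F) (Labels P ∘ upRowFree F))
  firstColumn = mk↔ₛ′
    (λ { ((nothing , x) , (p , κ)) → inj₂ p , x , κ ; ((just b , x) , κ) → inj₁ b , x , κ })
    (λ { (inj₂ p , x , κ) → (nothing , x) , (p , κ) ; (inj₁ b , x , κ) → (just b , x) , κ })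
    (λ { (inj₂ p , x , κ) → refl ; (inj₁ b , x , κ) → refl })
    (λ { ((nothing , x) , (p , κ)) → refl ; ((just b , x) , κ) → refl })
upRowLabels (false ∷ F) = upRowLabels F

PendingOrLeft : Set → Set → ∀ {n} → Vec Bool n → Set
PendingOrLeft B P F = (P × Labels P F) ⊎ Σ (LeftRow B F) (Labels P ∘ leftRowFree F)

-- Column by column, a left
-- arrow labelled b plays the role of the label inj₁ b.
leftRowLabels : ∀ {B P n} (F : Vec Bool n) → PendingOrLeft B P F ↔ (P × Labels (B ⊎ P) F)
leftRowLabels [] = mk↔ₛ′ (λ { (inj₁ pκ) → pκ ; (inj₂ (() , _)) }) inj₁ (λ _ → refl) λ { (inj₁ _) → refl ; (inj₂ (() , _)) }
leftRowLabels {B} {P} (true ∷ F) =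
  ↔-trans firstColumn (↔-trans (×-cong ↔-refl (leftRowLabels F)) (×-exchange (B ⊎ P) P (Labels (B ⊎ P) F)))
  where
  firstColumn : PendingOrLeft B P (true ∷ F) ↔ ((B ⊎ P) × PendingOrLeft B P F)
  firstColumn = mk↔ₛ′
    (λ { (inj₁ (p₀ , (p , κ)))                      → inj₂ p , inj₁ (p₀ , κ)
       ; (inj₂ (inj₁ b , (p₀ , κ)))                 → inj₁ b , inj₁ (p₀ , κ)
       ; (inj₂ (inj₂ (nothing , y) , (p , κ)))      → inj₂ p , inj₂ (y , κ)
       ; (inj₂ (inj₂ (just b , y) , κ))             → inj₁ b , inj₂ (y , κ) })
    (λ { (inj₂ p , inj₁ (p₀ , κ)) → inj₁ (p₀ , (p , κ))
       ; (inj₁ b , inj₁ (p₀ , κ)) → inj₂ (inj₁ b , (p₀ , κ))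
       ; (inj₂ p , inj₂ (y , κ))  → inj₂ (inj₂ (nothing , y) , (p , κ))
       ; (inj₁ b , inj₂ (y , κ))  → inj₂ (inj₂ (just b , y) , κ) })
    (λ { (inj₂ p , inj₁ _) → refl ; (inj₁ b , inj₁ _) → refl ; (inj₂ p , inj₂ _) → refl ; (inj₁ b , inj₂ _) → refl })
    (λ { (inj₁ _) → refl ; (inj₂ (inj₁ b , _)) → refl
       ; (inj₂ (inj₂ (nothing , y) , _)) → refl ; (inj₂ (inj₂ (just b , y) , _)) → refl })
leftRowLabels (false ∷ F) = leftRowLabels F

freeLabelled-step : ∀ {B P n} (F : Vec Bool n)
                  → Σ (⊤ ⊎ AdmissibleRow B F) (Labels P ∘ freeAfterRow F) ↔ ((⊤ ⊎ P) × Labels (B ⊎ P) F)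
freeLabelled-step {B} {P} F = begin
  Σ (⊤ ⊎ AdmissibleRow B F) (Labels P ∘ freeAfterRow F)
    ↔⟨ Σ-distribʳ-⊎ ⟩
  ((⊤ × (P × Labels P F)) ⊎ Σ (AdmissibleRow B F) (λ ρ → Labels P (removeUp F (map unlabel (proj₁ ρ)))))
    ↔⟨ ⊎-cong ⊤×↔ (Σ-↔ (rowClassification F) λ {ρ} → ≡⇒ (cong (Labels P) (removeUp-classify F ρ))) ⟩
  ((P × Labels P F) ⊎ Σ (RowKind B F) (Labels P ∘ remainingFree F))
    ↔⟨ ⊎-cong ↔-refl Σ-distribʳ-⊎ ⟩
  ((P × Labels P F) ⊎ (Σ (UpRow B F) (Labels P ∘ upRowFree F) ⊎ Σ (LeftRow B F) (Labels P ∘ leftRowFree F)))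
    ↔⟨ ⊎-exchange _ _ _ ⟩
  (Σ (UpRow B F) (Labels P ∘ upRowFree F) ⊎ PendingOrLeft B P F)
    ↔⟨ ⊎-cong (upRowLabels F) (leftRowLabels F) ⟩
  (Labels (B ⊎ P) F ⊎ (P × Labels (B ⊎ P) F))
    ↔⟨ ⊎-cong (↔-sym ⊤×↔) ↔-refl ⟩
  ((⊤ × Labels (B ⊎ P) F) ⊎ (P × Labels (B ⊎ P) F))
    ↔⟨ ×-distribʳ-⊎ ⟨
  ((⊤ ⊎ P) × Labels (B ⊎ P) F) ∎
  where open EquationalReasoning

noFreeRow-step : ∀ {B P n} (b : Bool) (F : Vec Bool n)
               → Σ (⊤ ⊎ AdmissibleRow B F) (λ e → T (noFreeRowAfterRow F b e) × Labels P (freeAfterRow F e))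
               ↔ (T b × (P × Labels (B ⊎ P) F))
noFreeRow-step {B} {P} b F = begin
  Σ (⊤ ⊎ AdmissibleRow B F) (λ e → T (noFreeRowAfterRow F b e) × Labels P (freeAfterRow F e))
    ↔⟨ Σ-distribʳ-⊎ ⟩
  ((⊤ × (T b × (P × Labels P F)))
    ⊎ Σ (AdmissibleRow B F) (λ ρ → T (hasLeft (map unlabel (proj₁ ρ)) ∧ b) × Labels P (removeUp F (map unlabel (proj₁ ρ)))))
    ↔⟨ ⊎-cong ⊤×↔ (Σ-↔ (rowClassification F) λ {ρ} →
         ≡⇒ (cong₂ (λ h L → T (h ∧ b) × Labels P L) (hasLeft-classify F ρ) (removeUp-classify F ρ))) ⟩
  ((T b × (P × Labels P F)) ⊎ Σ (RowKind B F) (λ z → T (isLeftRow F z ∧ b) × Labels P (remainingFree F z)))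
    ↔⟨ ⊎-cong ↔-refl Σ-distribʳ-⊎ ⟩
  ((T b × (P × Labels P F))
    ⊎ (Σ (UpRow B F) (λ x → ⊥ × Labels P (upRowFree F x)) ⊎ Σ (LeftRow B F) (λ y → T b × Labels P (leftRowFree F y))))
    ↔⟨ ⊎-cong ↔-refl (↔-trans (⊎-cong Σ-⊥× ↔-refl) ⊥⊎↔) ⟩
  ((T b × (P × Labels P F)) ⊎ Σ (LeftRow B F) (λ y → T b × Labels P (leftRowFree F y)))
    ↔⟨ ⊎-cong ↔-refl Σ-factor ⟩
  ((T b × (P × Labels P F)) ⊎ (T b × Σ (LeftRow B F) (Labels P ∘ leftRowFree F)))
    ↔⟨ ×-distribˡ-⊎ ⟨
  (T b × PendingOrLeft B P F)
    ↔⟨ ×-cong ↔-refl (leftRowLabels F) ⟩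
  (T b × (P × Labels (B ⊎ P) F)) ∎
  where open EquationalReasoning

FreeLabelled : Set → Set → ℕ → Set
FreeLabelled B P n = Σ (LTableau B n) (Labels P ∘ free)

NoFreeRowLabelled : Set → Set → ℕ → Set
NoFreeRowLabelled B P n = Σ (LTableau B n) (λ t → T (noFreeRows t) × Labels P (free t))

freeLabelled-suc : ∀ {B P} n → FreeLabelled B P (suc n) ↔ ((⊤ ⊎ P) × FreeLabelled B (B ⊎ P) n)
freeLabelled-suc {B} {P} n = begin
  Σ (LTableau B (suc n)) (Labels P ∘ free)
    ↔⟨ Σ-↔ firstStep (λ {t} → ≡⇒ (cong (Labels P) (free-peel t))) ⟩
  Σ (Extended B n) (Labels P ∘ freeAfter)
    ↔⟨ Σ-assoc ⟩
  Σ (LTableau B n) (λ t → Σ (Extension B t) (Labels P ∘ freeAfterRow (free t)))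
    ↔⟨ Σ-↔ ↔-refl (λ {t} → freeLabelled-step (free t)) ⟩
  Σ (LTableau B n) (λ t → (⊤ ⊎ P) × Labels (B ⊎ P) (free t))
    ↔⟨ Σ-factor ⟩
  ((⊤ ⊎ P) × FreeLabelled B (B ⊎ P) n) ∎
  where
  open EquationalReasoning
  open Peel B n

noFreeRowLabelled-suc : ∀ {B P} n → NoFreeRowLabelled B P (suc n) ↔ (P × NoFreeRowLabelled B (B ⊎ P) n)
noFreeRowLabelled-suc {B} {P} n = begin
  Σ (LTableau B (suc n)) (λ t → T (noFreeRows t) × Labels P (free t))
    ↔⟨ Σ-↔ firstStep (λ {t} → ≡⇒ (cong₂ (λ b L → T b × Labels P L) (noFreeRows-peel t) (free-peel t))) ⟩
  Σ (Extended B n) (λ e → T (noFreeRowAfter e) × Labels P (freeAfter e))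
    ↔⟨ Σ-assoc ⟩
  Σ (LTableau B n) (λ t → Σ (Extension B t) (λ e → T (noFreeRowAfterRow (free t) (noFreeRows t) e) × Labels P (freeAfterRow (free t) e)))
    ↔⟨ Σ-↔ ↔-refl (λ {t} → ↔-trans (noFreeRow-step (noFreeRows t) (free t)) (×-exchange _ _ _)) ⟩
  Σ (LTableau B n) (λ t → P × (T (noFreeRows t) × Labels (B ⊎ P) (free t)))
    ↔⟨ Σ-factor ⟩
  (P × NoFreeRowLabelled B (B ⊎ P) n) ∎
  where
  open EquationalReasoning
  open Peel B n

freeLabelled-zero : ∀ {B P} → FreeLabelled B P 0 ↔ ⊤
freeLabelled-zero = mk↔ₛ′ (λ _ → tt) (λ _ → ([] , [] , tt) , tt) (λ _ → refl) (λ { (([] , [] , _) , _) → refl })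

noFreeRowLabelled-zero : ∀ {B P} → NoFreeRowLabelled B P 0 ↔ ⊤
noFreeRowLabelled-zero = mk↔ₛ′ (λ _ → tt) (λ _ → ([] , [] , tt) , tt , tt) (λ _ → refl) (λ { (([] , [] , _) , _) → refl })

-- Induction on n with the two recursions; the hypothesis propagates
-- from (P , Q) to (Bool ⊎ P , ⊤ ⊎ Q).
correspondence : ∀ n {P Q : Set} → (⊤ ⊎ P) ↔ (Q × Bool)
               → FreeLabelled Bool P n ↔ (NoFreeRowLabelled ⊤ Q n × Vec Bool n)
correspondence zero {P} {Q} _ = begin
  FreeLabelled Bool P 0                      ↔⟨ freeLabelled-zero {Bool} {P} ⟩
  ⊤                                          ↔⟨ ⊤×↔ ⟨
  (⊤ × ⊤)                                    ↔⟨ ×-cong (noFreeRowLabelled-zero {⊤} {Q}) (vec-zero {Bool}) ⟨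
  (NoFreeRowLabelled ⊤ Q 0 × Vec Bool 0)     ∎
  where open EquationalReasoning
correspondence (suc n) {P} {Q} labelsMatch = begin
  FreeLabelled Bool P (suc n)
    ↔⟨ freeLabelled-suc n ⟩
  ((⊤ ⊎ P) × FreeLabelled Bool (Bool ⊎ P) n)
    ↔⟨ ×-cong labelsMatch (correspondence n labelsMatch′) ⟩
  ((Q × Bool) × (NoFreeRowLabelled ⊤ (⊤ ⊎ Q) n × Vec Bool n))
    ↔⟨ interchange ⟩
  ((Q × NoFreeRowLabelled ⊤ (⊤ ⊎ Q) n) × (Bool × Vec Bool n))
    ↔⟨ ×-cong (noFreeRowLabelled-suc n) vec-uncons ⟨
  (NoFreeRowLabelled ⊤ Q (suc n) × Vec Bool (suc n)) ∎
  where
  open EquationalReasoning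
  interchange : ∀ {X Y Z W : Set} → ((X × Y) × (Z × W)) ↔ ((X × Z) × (Y × W))
  interchange = mk↔ₛ′ (λ ((x , y) , (z , w)) → (x , z) , (y , w)) (λ ((x , z) , (y , w)) → (x , y) , (z , w))
                      (λ _ → refl) (λ _ → refl)
  labelsMatch′ : (⊤ ⊎ (Bool ⊎ P)) ↔ ((⊤ ⊎ Q) × Bool)
  labelsMatch′ = begin
    (⊤ ⊎ (Bool ⊎ P))          ↔⟨ ⊎-exchange ⊤ Bool P ⟩
    (Bool ⊎ (⊤ ⊎ P))          ↔⟨ ⊎-cong (↔-sym ⊤×↔) labelsMatch ⟩
    ((⊤ × Bool) ⊎ (Q × Bool)) ↔⟨ ×-distribʳ-⊎ ⟨
    ((⊤ ⊎ Q) × Bool)          ∎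

labels-⊤ : ∀ {n} (F : Vec Bool n) → Labels ⊤ F ↔ ⊤
labels-⊤ []          = ↔-refl
labels-⊤ (true ∷ F)  = ↔-trans (×-cong ↔-refl (labels-⊤ F)) ⊤×↔
labels-⊤ (false ∷ F) = labels-⊤ F

decoratedTableaux : ∀ n → FreeLabelled Bool ⊤ n ↔ DecAltTableau n
decoratedTableaux n = ↔-trans (Σ-↔ ↔-refl (λ {t} → labels-⊤ (free t))) ×⊤↔

label : Maybe Arrow → Labelled ⊤
label = Maybe.map (_, tt)

map²-inverse : ∀ {A C : Set} (f : A → C) (g : C → A) → (∀ x → g (f x) ≡ x)
             → ∀ {m n} (v : Vec (Vec A n) m) → map (map g) (map (map f) v) ≡ v
map²-inverse f g inverse v = begin
  map (map g) (map (map f) v)   ≡⟨ map-∘ (map g) (map f) v ⟨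
  map (map g ∘ map f) v         ≡⟨ map-cong rowInverse v ⟩
  map (λ r → r) v               ≡⟨ map-id v ⟩
  v                             ∎
  where
  open ≡-Reasoning
  rowInverse : ∀ {n} (r : Vec _ n) → map g (map f r) ≡ r
  rowInverse r = trans (sym (map-∘ g f r)) (trans (map-cong inverse r) (map-id r))

unlabelling : ∀ {n} → LFilling ⊤ n ↔ Filling n
unlabelling = mk↔ₛ′ unlabelRows (map (map label))
  (map²-inverse label unlabel λ { nothing → refl ; (just _) → refl })
  (map²-inverse unlabel label λ { nothing → refl ; (just _) → refl })

plainTableaux : ∀ n → NoFreeRowLabelled ⊤ ⊤ n ↔ AltTableauNoFreeRow n
plainTableaux n = begin
  Σ (LTableau ⊤ n) (λ t → T (noFreeRows t) × Labels ⊤ (free t))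
    ↔⟨ Σ-↔ ↔-refl (λ {t} → ↔-trans (×-cong ↔-refl (labels-⊤ (free t))) ×⊤↔) ⟩
  Σ (LTableau ⊤ n) (T ∘ noFreeRows)
    ↔⟨ Σ-↔ (Σ-↔ ↔-refl (Σ-↔ unlabelling ↔-refl)) ↔-refl ⟩
  AltTableauNoFreeRow n ∎
  where open EquationalReasoning

twoLabels : (⊤ ⊎ ⊤) ↔ (⊤ × Bool)
twoLabels = mk↔ₛ′ (λ { (inj₁ _) → tt , true ; (inj₂ _) → tt , false })
                  (λ { (_ , true) → inj₁ tt ; (_ , false) → inj₂ tt })
                  (λ { (_ , true) → refl ; (_ , false) → refl })
                  (λ { (inj₁ _) → refl ; (inj₂ _) → refl })

proposition3p5 : (n : ℕ) → DecAltTableau n ↔ (AltTableauNoFreeRow n × RowColSubset n)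
proposition3p5 n = begin
  DecAltTableau n                                ↔⟨ decoratedTableaux n ⟨
  FreeLabelled Bool ⊤ n                          ↔⟨ correspondence n twoLabels ⟩
  (NoFreeRowLabelled ⊤ ⊤ n × Vec Bool n)         ↔⟨ ×-cong (plainTableaux n) ↔-refl ⟩
  (AltTableauNoFreeRow n × RowColSubset n)       ∎
  where open EquationalReasoning
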